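{- Let $G=(V,E)$ be a thin connected digraph and $v\in V$. Let $S^+(v)=\{u\in V: N^+[u]=N^+[v]\}$ and $S^-(v)=\{u\in V: N^-[u]=N^-[v]\}$. Then all vertices of $S^+(v)$ lie in the same connected component of $\mathbb S(G)$, i.e. any two vertices $x,y\in S^+(v)$ are joined by a walk in $\mathbb S(G)$ (consisting of non-dispensable edges only). The same holds for $S^-(v)$.
   Context: All digraphs are finite and simple without loops: $G=(V,E)$ with $E\subseteq\{(x,y)\in V\times V: x\neq y\}$; edges $(x,y)$ are written $xy$. Closed neighborhoods: $N^+[v]=\{x: vx\in E\}\cup\{v\}$, $N^-[v]=\{x: xv\in E\}\cup\{v\}$. A walk joining $x$ and $y$ is a sequence $x=x_0,\dots,x_n=y$ with $x_ix_{i+1}\in E$ or $x_{i+1}x_i\in E$ for each $i$; a digraph is connected if any two vertices are joined by a walk (weak connectivity), and connected components are understood in this sense. A digraph is thin if for all distinct vertices $x,y$, $N^+[x]\neq N^+[y]$ or $N^-[x]\neq N^-[y]$. In what follows $\subset$ denotes proper inclusion. For an edge $xy$ and a vertex $z$: $xy$ satisfies the $N^+$-condition with $z$ if $(1^+)$ $N^+[x]\subset N^+[z]\subset N^+[y]$, or $(2^+)$ $N^+[y]\subset N^+[z]\subset N^+[x]$, or $(3^+)$ $N^+[x]\cap N^+[y]\subset N^+[x]\cap N^+[z]$ and $N^+[x]\cap N^+[y]\subset N^+[y]\cap N^+[z]$; $xy$ satisfies the weak $N^+$-condition with $z$ if $N^+[x]\cap N^+[y]\subseteq N^+[x]\cap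 N^+[z]$ and $N^+[x]\cap N^+[y]\subseteq N^+[y]\cap N^+[z]$. The conditions $(1^-),(2^-),(3^-)$, the $N^-$-condition and the weak $N^-$-condition are defined identically with $N^-$ in place of $N^+$. An edge $xy$ is dispensable if at least one holds: (D1) there is $z$ such that $xy$ satisfies the $N^+$-condition and the $N^-$-condition with $z$; (D2) there are $z_1,z_2$ such that (a) $xy$ satisfies $(3^+)$ with $z_1$ and the weak $N^-$-condition with $z_1$, and (b) $xy$ satisfies $(3^-)$ with $z_2$ and the weak $N^+$-condition with $z_2$; (D3) there is $z$ such that $xy$ satisfies the $N^+$-condition with $z$ and $N^-[x]=N^-[z]$ or $N^-[y]=N^-[z]$; (D4) there is $z$ such that $xy$ satisfies the $N^-$-condition with $z$ and $N^+[x]=N^+[z]$ or $N^+[y]=N^+[z]$; (D5) there are distinct vertices $z_1,z_2$, both distinct from $x$ and $y$, with $N^+[x]=N^+[z_1]$, $N^-[x]=N^-[z_2]$, $N^-[z_1]=N^-[y]$ and $N^+[z_2]=N^+[y]$. The Cartesian skeleton $\mathbb S(G)$ is the digraph with vertex set $V$ and edge set $E$ minus the set of dispensable edges. -}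

module Defs where

open import Data.Nat using (ℕ)
open import Data.Fin using (Fin)
open import Data.Bool using (Bool; true; false; T)
open import Data.Product using (_×_; Σ; ∃; ∃-syntax; _,_)
open import Data.Sum using (_⊎_)
open import Level using (0ℓ)
open import Relation.Nullary using (¬_)
open import Relation.Binary.PropositionalEquality using (_≡_; _≢_)
open import Relation.Unary using (Pred; _⊆_; _⊂_; _≐_; _∩_)

record Digraph : Set where
  field
    n      : ℕ
    adj    : Fin n → Fin n → Bool
    noLoop : ∀ x → adj x x ≡ false

module _ (G : Digraph) where
  open Digraph G

  V : Set
  V = Fin n

  Edge : V → V → Set
  Edge x y = T (adj x y)

  N⁺ : V → Pred V 0ℓ
  N⁺ v w = w ≡ v ⊎ Edge v w

  N⁻ : V → Pred V 0ℓ
  N⁻ v w = w ≡ v ⊎ Edge w v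

data Walk {A : Set} (R : A → A → Set) : A → A → Set where
  []  : ∀ {x} → Walk R x x
  _∷_ : ∀ {x y z} → (R x y ⊎ R y x) → Walk R y z → Walk R x z

module _ (G : Digraph) where
  open Digraph G using (n)

  Connected : Set
  Connected = ∀ (x y : V G) → Walk (Edge G) x y

  Thin : Set
  Thin = ∀ (x y : V G) → x ≢ y → (¬ (N⁺ G x ≐ N⁺ G y)) ⊎ (¬ (N⁻ G x ≐ N⁻ G y))

module _ {A : Set} (N : A → Pred A 0ℓ) where

  Cond1 : A → A → A → Set
  Cond1 x y z = (N x ⊂ N z) × (N z ⊂ N y)

  Cond2 : A → A → A → Set
  Cond2 x y z = (N y ⊂ N z) × (N z ⊂ N x)

  Cond3 : A → A → A → Set
  Cond3 x y z = ((N x ∩ N y) ⊂ (N x ∩ N z)) × ((N x ∩ N y) ⊂ (N y ∩ N z))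

  NCond : A → A → A → Set
  NCond x y z = Cond1 x y z ⊎ Cond2 x y z ⊎ Cond3 x y z

  WeakCond : A → A → A → Set
  WeakCond x y z = ((N x ∩ N y) ⊆ (N x ∩ N z)) × ((N x ∩ N y) ⊆ (N y ∩ N z))

module _ (G : Digraph) where

  D1 : V G → V G → Set
  D1 x y = ∃[ z ] (NCond (N⁺ G) x y z × NCond (N⁻ G) x y z)

  D2 : V G → V G → Set
  D2 x y = ∃[ z₁ ] ∃[ z₂ ]
             ((Cond3 (N⁺ G) x y z₁ × WeakCond (N⁻ G) x y z₁)
             × (Cond3 (N⁻ G) x y z₂ × WeakCond (N⁺ G) x y z₂))

  D3 : V G → V G → Set
  D3 x y = ∃[ z ] (NCond (N⁺ G) x y z × ((N⁻ G x ≐ N⁻ G z) ⊎ (N⁻ G y ≐ N⁻ G z)))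

  D4 : V G → V G → Set
  D4 x y = ∃[ z ] (NCond (N⁻ G) x y z × ((N⁺ G x ≐ N⁺ G z) ⊎ (N⁺ G y ≐ N⁺ G z)))

  D5 : V G → V G → Set
  D5 x y = ∃[ z₁ ] ∃[ z₂ ]
             (z₁ ≢ z₂ × z₁ ≢ x × z₁ ≢ y × z₂ ≢ x × z₂ ≢ y
             × (N⁺ G x ≐ N⁺ G z₁) × (N⁻ G x ≐ N⁻ G z₂)
             × (N⁻ G z₁ ≐ N⁻ G y) × (N⁺ G z₂ ≐ N⁺ G y))

  Dispensable : V G → V G → Set
  Dispensable x y = D1 x y ⊎ D2 x y ⊎ D3 x y ⊎ D4 x y ⊎ D5 x y

  SkelEdge : V G → V G → Set
  SkelEdge x y = Edge G x y × ¬ Dispensable x y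

-- For x ≠ y in S⁺(v), N⁺[x] = N⁺[y] forces the edge xy and rules out (D1)–(D3), while (D5)
-- would give a vertex with the same in- and out-neighbourhood as x, contradicting thinness.
-- So xy leaves the skeleton only through (D4), i.e. because some z ∈ S⁺(v) satisfies the
-- N⁻-condition with xy.  Such a z splits the pair (x, y) into (x, z) and (z, y), each with a
-- strictly larger common in-neighbourhood, or with the same one and strictly smaller
-- in-neighbourhoods.  Splitting recursively therefore terminates and leaves a walk from x to
-- y inside S⁺(v) that uses skeleton edges only.  S⁻(v) is dual.
module Submission where

open import Defs
open import Data.Empty using (⊥-elim)
open import Data.Fin using (Fin; zero; suc; _≟_)
open import Data.Fin.Properties using (any?; all?; ¬∀⟶∃¬)
open import Data.Nat using (ℕ; zero; suc; _+_; _∸_; _≤_; _<_; z≤n; s≤s)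
open import Data.Nat.Properties
  using (m≤n⇒m≤1+n; m<n⇒m<1+n; ≤-antisym; +-monoʳ-<; +-monoˡ-<; ∸-monoʳ-<)
open import Data.Product using (_×_; ∃-syntax; _,_; proj₁; proj₂)
open import Data.Product.Relation.Binary.Lex.Strict using (×-Lex; ×-wellFounded)
open import Data.Nat.Induction using (<-wellFounded)
open import Data.Sum using (inj₁; inj₂)
open import Function using (_∘_; _on_; const)
open import Induction.WellFounded using (WellFounded; Acc; acc)
open import Level using (0ℓ)
open import Relation.Binary using (Rel)
open import Relation.Binary.PropositionalEquality using (_≡_; _≢_; refl; sym; cong)
import Relation.Binary.Construct.On as On
open import Relation.Nullary using (¬_; Dec; yes; no)
open import Relation.Nullary.Decidable using (_×-dec_; _⊎-dec_; _→-dec_; ¬?; T?; map′; decidable-stable)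
open import Relation.Unary using (Pred; Decidable; _⊆_; _⊂_; _≐_; _∩_)
open import Relation.Unary.Properties
  using (⊂-respʳ-≐; ⊂-respˡ-≐; ≐-sym; ≐-trans; _∩?_)
open import Relation.Unary.Algebra using (∩-comm)

_++ʷ_ : ∀ {A : Set} {R : Rel A 0ℓ} {x y z} → Walk R x y → Walk R y z → Walk R x z
[]      ++ʷ q = q
(e ∷ p) ++ʷ q = e ∷ (p ++ʷ q)

count : ∀ {n} {P : Pred (Fin n) 0ℓ} → Decidable P → ℕ
count {zero}  P? = 0
count {suc n} P? with P? zero
... | yes _ = suc (count (P? ∘ suc))
... | no  _ = count (P? ∘ suc)

count≤n : ∀ {n} {P : Pred (Fin n) 0ℓ} (P? : Decidable P) → count P? ≤ n
count≤n {zero}  P? = z≤n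
count≤n {suc n} P? with P? zero
... | yes _ = s≤s (count≤n (P? ∘ suc))
... | no  _ = m≤n⇒m≤1+n (count≤n (P? ∘ suc))

count-mono : ∀ {n} {P Q : Pred (Fin n) 0ℓ} (P? : Decidable P) (Q? : Decidable Q) →
             P ⊆ Q → count P? ≤ count Q?
count-mono {zero}  P? Q? P⊆Q = z≤n
count-mono {suc n} P? Q? P⊆Q with P? zero | Q? zero
... | yes _ | yes _  = s≤s (count-mono (P? ∘ suc) (Q? ∘ suc) P⊆Q)
... | yes p | no ¬q  = ⊥-elim (¬q (P⊆Q p))
... | no _  | yes _  = m≤n⇒m≤1+n (count-mono (P? ∘ suc) (Q? ∘ suc) P⊆Q)
... | no _  | no _   = count-mono (P? ∘ suc) (Q? ∘ suc) P⊆Q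

count-cong : ∀ {n} {P Q : Pred (Fin n) 0ℓ} (P? : Decidable P) (Q? : Decidable Q) →
             P ≐ Q → count P? ≡ count Q?
count-cong P? Q? (P⊆Q , Q⊆P) = ≤-antisym (count-mono P? Q? P⊆Q) (count-mono Q? P? Q⊆P)

count-< : ∀ {n} {P Q : Pred (Fin n) 0ℓ} (P? : Decidable P) (Q? : Decidable Q) →
              P ⊆ Q → ∀ i → Q i → ¬ P i → count P? < count Q?
count-< {suc n} P? Q? P⊆Q zero Qi ¬Pi with P? zero | Q? zero
... | yes p | _      = ⊥-elim (¬Pi p)
... | no _  | no ¬q  = ⊥-elim (¬q Qi)
... | no _  | yes _  = s≤s (count-mono (P? ∘ suc) (Q? ∘ suc) P⊆Q)
count-< {suc n} P? Q? P⊆Q (suc i) Qi ¬Pi with P? zero | Q? zero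
... | yes _ | yes _  = s≤s (count-< (P? ∘ suc) (Q? ∘ suc) P⊆Q i Qi ¬Pi)
... | yes p | no ¬q  = ⊥-elim (¬q (P⊆Q p))
... | no _  | yes _  = m<n⇒m<1+n (count-< (P? ∘ suc) (Q? ∘ suc) P⊆Q i Qi ¬Pi)
... | no _  | no _   = count-< (P? ∘ suc) (Q? ∘ suc) P⊆Q i Qi ¬Pi

⊈⇒∃ : ∀ {n} {P Q : Pred (Fin n) 0ℓ} → Decidable P → Decidable Q →
      ¬ (Q ⊆ P) → ∃[ i ] (Q i × ¬ P i)
⊈⇒∃ {n} P? Q? Q⊈P with ¬∀⟶∃¬ n _ (λ i → Q? i →-dec P? i) (λ Q⇒P → Q⊈P (Q⇒P _))
... | i , ¬[Qi⇒Pi] =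
  i , decidable-stable (Q? i) (λ ¬Qi → ¬[Qi⇒Pi] (⊥-elim ∘ ¬Qi)) , ¬[Qi⇒Pi] ∘ const

count-⊂ : ∀ {n} {P Q : Pred (Fin n) 0ℓ} (P? : Decidable P) (Q? : Decidable Q) →
          P ⊂ Q → count P? < count Q?
count-⊂ P? Q? (P⊆Q , Q⊈P) with ⊈⇒∃ P? Q? Q⊈P
... | i , Qi , ¬Pi = count-< P? Q? P⊆Q i Qi ¬Pi

module _ {n : ℕ} where

  infix 4 _⊆?_ _⊂?_ _≐?_

  _⊆?_ : {P Q : Pred (Fin n) 0ℓ} → Decidable P → Decidable Q → Dec (P ⊆ Q)
  P? ⊆? Q? = map′ (λ P⇒Q {i} → P⇒Q i) (λ P⊆Q _ → P⊆Q) (all? λ i → P? i →-dec Q? i)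

  _⊂?_ : {P Q : Pred (Fin n) 0ℓ} → Decidable P → Decidable Q → Dec (P ⊂ Q)
  P? ⊂? Q? = (P? ⊆? Q?) ×-dec ¬? (Q? ⊆? P?)

  _≐?_ : {P Q : Pred (Fin n) 0ℓ} → Decidable P → Decidable Q → Dec (P ≐ Q)
  P? ≐? Q? = (P? ⊆? Q?) ×-dec (Q? ⊆? P?)

module _ {A : Set} {P Q : Pred A 0ℓ} where

  ∩-absorbˡ : P ⊆ Q → P ∩ Q ≐ P
  ∩-absorbˡ P⊆Q = proj₁ , λ p → p , P⊆Q p

  ∩-absorbʳ : Q ⊆ P → P ∩ Q ≐ Q
  ∩-absorbʳ Q⊆P = proj₂ , λ q → Q⊆P q , q

module _ {A : Set} (N : A → Pred A 0ℓ) {x y z : A} where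

  ≐⇒¬Cond3 : N x ≐ N y → ¬ Cond3 N x y z
  ≐⇒¬Cond3 (_ , Ny⊆Nx) (_ , (_ , ¬⊆)) = ¬⊆ λ (Ny , _) → Ny⊆Nx Ny , Ny

  ≐⇒¬NCond : N x ≐ N y → ¬ NCond N x y z
  ≐⇒¬NCond (_ , Ny⊆Nx) (inj₁ ((Nx⊆Nz , _) , (_ , Ny⊈Nz))) = Ny⊈Nz (Nx⊆Nz ∘ Ny⊆Nx)
  ≐⇒¬NCond (Nx⊆Ny , _) (inj₂ (inj₁ ((Ny⊆Nz , _) , (_ , Nx⊈Nz)))) = Nx⊈Nz (Ny⊆Nz ∘ Nx⊆Ny)
  ≐⇒¬NCond Nx≐Ny (inj₂ (inj₂ cond3)) = ≐⇒¬Cond3 Nx≐Ny cond3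

module _ {A : Set} {P P′ Q′ Q : Pred A 0ℓ} where

  ≐-⊂-≐ : P ≐ P′ → P′ ⊂ Q′ → Q′ ≐ Q → P ⊂ Q
  ≐-⊂-≐ P≐P′ P′⊂Q′ Q′≐Q = ⊂-respʳ-≐ Q′≐Q (⊂-respˡ-≐ (≐-sym P≐P′) P′⊂Q′)

module Splitting {n : ℕ} (N : Fin n → Pred (Fin n) 0ℓ) (N? : ∀ x → Decidable (N x)) where

  measure : Fin n × Fin n → ℕ × ℕ
  measure (x , y) = n ∸ count (N? x ∩? N? y) , count (N? x) + count (N? y)

  _≺_ : Rel (Fin n × Fin n) 0ℓ
  _≺_ = ×-Lex _≡_ _<_ _<_ on measure

  ≺-wellFounded : WellFounded _≺_
  ≺-wellFounded = On.wellFounded measure (×-wellFounded <-wellFounded <-wellFounded)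

  module _ {p q x y : Fin n} where

    ∩-⊂⇒≺ : N x ∩ N y ⊂ N p ∩ N q → (p , q) ≺ (x , y)
    ∩-⊂⇒≺ ⊂ = inj₁ (∸-monoʳ-< (count-⊂ (N? x ∩? N? y) (N? p ∩? N? q) ⊂) (count≤n (N? p ∩? N? q)))

    ∩-≐⇒≺ : N x ∩ N y ≐ N p ∩ N q →
            count (N? p) + count (N? q) < count (N? x) + count (N? y) → (p , q) ≺ (x , y)
    ∩-≐⇒≺ ≐ < = inj₂ (cong (n ∸_) (count-cong (N? p ∩? N? q) (N? x ∩? N? y) (≐-sym ≐)) , <)

  module _ {x y z : Fin n} where

    Cond1⇒≺ : Cond1 N x y z → (x , z) ≺ (x , y) × (z , y) ≺ (x , y)
    Cond1⇒≺ (Nx⊂Nz@(Nx⊆Nz , _) , Nz⊂Ny@(Nz⊆Ny , _)) =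
        ∩-≐⇒≺ (≐-trans (∩-absorbˡ (Nz⊆Ny ∘ Nx⊆Nz)) (≐-sym (∩-absorbˡ Nx⊆Nz)))
              (+-monoʳ-< (count (N? x)) (count-⊂ (N? z) (N? y) Nz⊂Ny))
      , ∩-⊂⇒≺ (≐-⊂-≐ (∩-absorbˡ (Nz⊆Ny ∘ Nx⊆Nz)) Nx⊂Nz (≐-sym (∩-absorbˡ Nz⊆Ny)))

    Cond2⇒≺ : Cond2 N x y z → (x , z) ≺ (x , y) × (z , y) ≺ (x , y)
    Cond2⇒≺ (Ny⊂Nz@(Ny⊆Nz , _) , Nz⊂Nx@(Nz⊆Nx , _)) =
        ∩-⊂⇒≺ (≐-⊂-≐ (∩-absorbʳ (Nz⊆Nx ∘ Ny⊆Nz)) Ny⊂Nz (≐-sym (∩-absorbʳ Nz⊆Nx)))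
      , ∩-≐⇒≺ (≐-trans (∩-absorbʳ (Nz⊆Nx ∘ Ny⊆Nz)) (≐-sym (∩-absorbʳ Ny⊆Nz)))
              (+-monoˡ-< (count (N? y)) (count-⊂ (N? z) (N? x) Nz⊂Nx))

    Cond3⇒≺ : Cond3 N x y z → (x , z) ≺ (x , y) × (z , y) ≺ (x , y)
    Cond3⇒≺ (⊂Nx∩Nz , ⊂Ny∩Nz) = ∩-⊂⇒≺ ⊂Nx∩Nz , ∩-⊂⇒≺ (⊂-respʳ-≐ (∩-comm (N y) (N z)) ⊂Ny∩Nz)

    NCond⇒≺ : NCond N x y z → (x , z) ≺ (x , y) × (z , y) ≺ (x , y)
    NCond⇒≺ (inj₁ cond1)        = Cond1⇒≺ cond1
    NCond⇒≺ (inj₂ (inj₁ cond2)) = Cond2⇒≺ cond2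
    NCond⇒≺ (inj₂ (inj₂ cond3)) = Cond3⇒≺ cond3

  NCond? : ∀ x y z → Dec (NCond N x y z)
  NCond? x y z =
    ((N? x ⊂? N? z) ×-dec (N? z ⊂? N? y))
    ⊎-dec ((N? y ⊂? N? z) ×-dec (N? z ⊂? N? x))
    ⊎-dec (((N? x ∩? N? y) ⊂? (N? x ∩? N? z)) ×-dec ((N? x ∩? N? y) ⊂? (N? y ∩? N? z)))

  module _ {C : Pred (Fin n) 0ℓ} (C? : Decidable C) {R : Rel (Fin n) 0ℓ}
    (unsplittable⇒R : ∀ {x y} → C x → C y → x ≢ y →
                      (∀ {z} → C z → ¬ NCond N x y z) → R x y) where

    walk-within : ∀ x y → C x → C y → Walk R x y
    walk-within x y = go (≺-wellFounded (x , y))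
      where
      go : ∀ {x y} → Acc _≺_ (x , y) → C x → C y → Walk R x y
      go {x} {y} (acc rec) Cx Cy with x ≟ y | any? (λ z → C? z ×-dec NCond? x y z)
      ... | yes refl | _                 = []
      ... | no x≢y   | no ∄z             =
        inj₁ (unsplittable⇒R Cx Cy x≢y (λ Cz cond → ∄z (_ , Cz , cond))) ∷ []
      ... | no _     | yes (z , Cz , cond) =
        go (rec (proj₁ (NCond⇒≺ cond))) Cx Cz ++ʷ go (rec (proj₂ (NCond⇒≺ cond))) Cz Cy

module _ (G : Digraph) where
  open Digraph G using (adj)

  N⁺? : ∀ x → Decidable (N⁺ G x)
  N⁺? x w = (w ≟ x) ⊎-dec T? (adj x w)

  N⁻? : ∀ x → Decidable (N⁻ G x)
  N⁻? x w = (w ≟ x) ⊎-dec T? (adj w x)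

module _ (G : Digraph) (thin : Thin G) {v x y : V G} where

  sameN⁺⇒SkelEdge : N⁺ G x ≐ N⁺ G v → N⁺ G y ≐ N⁺ G v → x ≢ y →
                    (∀ {z} → N⁺ G z ≐ N⁺ G v → ¬ NCond (N⁻ G) x y z) → SkelEdge G x y
  sameN⁺⇒SkelEdge Nx≐Nv Ny≐Nv x≢y unsplittable = edge (proj₂ Nx≐Ny (inj₁ refl)) , ¬dispensable
    where
    Nx≐Ny : N⁺ G x ≐ N⁺ G y
    Nx≐Ny = ≐-trans Nx≐Nv (≐-sym Ny≐Nv)

    edge : N⁺ G x y → Edge G x y
    edge (inj₁ y≡x) = ⊥-elim (x≢y (sym y≡x))
    edge (inj₂ xy)  = xy

    ¬dispensable : ¬ Dispensable G x y
    ¬dispensable (inj₁ (_ , cond⁺ , _))                  = ≐⇒¬NCond (N⁺ G) Nx≐Ny cond⁺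
    ¬dispensable (inj₂ (inj₁ (_ , _ , (cond3⁺ , _) , _))) = ≐⇒¬Cond3 (N⁺ G) Nx≐Ny cond3⁺
    ¬dispensable (inj₂ (inj₂ (inj₁ (_ , cond⁺ , _))))     = ≐⇒¬NCond (N⁺ G) Nx≐Ny cond⁺
    ¬dispensable (inj₂ (inj₂ (inj₂ (inj₁ (_ , cond⁻ , inj₁ Nx≐Nz))))) =
      unsplittable (≐-trans (≐-sym Nx≐Nz) Nx≐Nv) cond⁻
    ¬dispensable (inj₂ (inj₂ (inj₂ (inj₁ (_ , cond⁻ , inj₂ Ny≐Nz))))) =
      unsplittable (≐-trans (≐-sym Ny≐Nz) Ny≐Nv) cond⁻
    ¬dispensable (inj₂ (inj₂ (inj₂ (inj₂ (_ , z₂ , _ , _ , _ , z₂≢x , _ , _ , N⁻x≐N⁻z₂ , _ , N⁺z₂≐N⁺y)))))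
      with thin z₂ x z₂≢x
    ... | inj₁ N⁺z₂≉N⁺x = N⁺z₂≉N⁺x (≐-trans N⁺z₂≐N⁺y (≐-sym Nx≐Ny))
    ... | inj₂ N⁻z₂≉N⁻x = N⁻z₂≉N⁻x (≐-sym N⁻x≐N⁻z₂)

  sameN⁻⇒SkelEdge : N⁻ G x ≐ N⁻ G v → N⁻ G y ≐ N⁻ G v → x ≢ y →
                    (∀ {z} → N⁻ G z ≐ N⁻ G v → ¬ NCond (N⁺ G) x y z) → SkelEdge G x y
  sameN⁻⇒SkelEdge Nx≐Nv Ny≐Nv x≢y unsplittable = edge (proj₁ Nx≐Ny (inj₁ refl)) , ¬dispensable
    where
    Nx≐Ny : N⁻ G x ≐ N⁻ G y
    Nx≐Ny = ≐-trans Nx≐Nv (≐-sym Ny≐Nv)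

    edge : N⁻ G y x → Edge G x y
    edge (inj₁ x≡y) = ⊥-elim (x≢y x≡y)
    edge (inj₂ xy)  = xy

    ¬dispensable : ¬ Dispensable G x y
    ¬dispensable (inj₁ (_ , _ , cond⁻))                  = ≐⇒¬NCond (N⁻ G) Nx≐Ny cond⁻
    ¬dispensable (inj₂ (inj₁ (_ , _ , _ , (cond3⁻ , _)))) = ≐⇒¬Cond3 (N⁻ G) Nx≐Ny cond3⁻
    ¬dispensable (inj₂ (inj₂ (inj₁ (_ , cond⁺ , inj₁ Nx≐Nz)))) =
      unsplittable (≐-trans (≐-sym Nx≐Nz) Nx≐Nv) cond⁺
    ¬dispensable (inj₂ (inj₂ (inj₁ (_ , cond⁺ , inj₂ Ny≐Nz)))) =
      unsplittable (≐-trans (≐-sym Ny≐Nz) Ny≐Nv) cond⁺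
    ¬dispensable (inj₂ (inj₂ (inj₂ (inj₁ (_ , cond⁻ , _)))))   = ≐⇒¬NCond (N⁻ G) Nx≐Ny cond⁻
    ¬dispensable (inj₂ (inj₂ (inj₂ (inj₂ (z₁ , _ , _ , z₁≢x , _ , _ , _ , N⁺x≐N⁺z₁ , _ , N⁻z₁≐N⁻y , _)))))
      with thin z₁ x z₁≢x
    ... | inj₁ N⁺z₁≉N⁺x = N⁺z₁≉N⁺x (≐-sym N⁺x≐N⁺z₁)
    ... | inj₂ N⁻z₁≉N⁻x = N⁻z₁≉N⁻x (≐-trans N⁻z₁≐N⁻y (≐-sym Nx≐Ny))

lemma14 : (G : Digraph) → Thin G → Connected G → (v : V G) →
    ((x y : V G) → N⁺ G x ≐ N⁺ G v → N⁺ G y ≐ N⁺ G v → Walk (SkelEdge G) x y)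
    × ((x y : V G) → N⁻ G x ≐ N⁻ G v → N⁻ G y ≐ N⁻ G v → Walk (SkelEdge G) x y)
lemma14 G thin _ v =
    Splitting.walk-within (N⁻ G) (N⁻? G) (λ z → N⁺? G z ≐? N⁺? G v) (sameN⁺⇒SkelEdge G thin)
  , Splitting.walk-within (N⁺ G) (N⁺? G) (λ z → N⁻? G z ≐? N⁻? G v) (sameN⁻⇒SkelEdge G thin)
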